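{- Let $G$ be a $w\times h$ rectangular grid graph. In every threading of $G$, at every vertex $v$ the threading makes at least one $90$-degree turn, i.e., at least once it passes through $v$ between two perpendicular edges incident to $v$.
   Context: A $w\times h$ rectangular grid graph is the lattice graph with $w$ rows and $h$ columns of vertices, adjacent vertices being horizontal or vertical neighbours. A turn at $v$ is an unordered pair of distinct edges incident to $v$; it is a $90$-degree turn (cost $1$) if the edges are perpendicular and straight (cost $0$) if collinear. The junction graph $J(v)$ induced by a closed walk at vertex $v$ has one vertex for each edge incident to $v$, and an edge between two of these vertices every time the walk visits $v$ immediately in between traversing the corresponding two edges. A threading is a closed walk that traverses every edge at least once, has no U-turns (never traverses the same edge twice in immediate succession, cyclically), and induces a connected junction graph at every vertex. -}

module Defs where

open import Data.Nat using (ℕ; zero; suc; _+_)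
open import Data.Nat.DivMod using (_mod_)
open import Data.Fin using (Fin; toℕ)
open import Data.Product using (_×_; _,_; ∃; proj₁; proj₂)
open import Data.Sum using (_⊎_)
open import Relation.Nullary using (¬_)
open import Relation.Binary.PropositionalEquality using (_≡_)
open import Relation.Binary.Construct.Closure.ReflexiveTransitive using (Star)

Vertex : ℕ → ℕ → Set
Vertex w h = Fin w × Fin h

module _ {w h : ℕ} where

  row : Vertex w h → Fin w
  row = proj₁

  col : Vertex w h → Fin h
  col = proj₂

  Step : {n : ℕ} → Fin n → Fin n → Set
  Step a b = (suc (toℕ a) ≡ toℕ b) ⊎ (suc (toℕ b) ≡ toℕ a)

  Adj : Vertex w h → Vertex w h → Set
  Adj a b = (row a ≡ row b × Step (col a) (col b))
          ⊎ (col a ≡ col b × Step (row a) (row b))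

  -- the edge {a,b} (assumed adjacent) is horizontal: endpoints in same row
  Horizontal : Vertex w h → Vertex w h → Set
  Horizontal a b = row a ≡ row b

  Perpendicular : Vertex w h → Vertex w h → Vertex w h → Set
  Perpendicular v u u' = (Horizontal v u × ¬ Horizontal v u')
                       ⊎ (¬ Horizontal v u × Horizontal v u')

-- A closed walk of length L = suc n (number of edges, ≥ 1) in the grid:
-- a cyclic vertex sequence v₀ … v_{L-1}, edges {vᵢ , v_{i+1 mod L}}.
record ClosedWalk (w h : ℕ) : Set where
  field
    n     : ℕ
    verts : Fin (suc n) → Vertex w h
  at : ℕ → Vertex w h
  at i = verts (i mod suc n)
  field
    adjacent : ∀ i → Adj (at i) (at (suc i))

module _ {w h : ℕ} (W : ClosedWalk w h) where
  open ClosedWalk W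

  Traverses : Vertex w h → Vertex w h → Set
  Traverses u u' = ∃ λ i → (at i ≡ u × at (suc i) ≡ u') ⊎ (at i ≡ u' × at (suc i) ≡ u)

  CoversAllEdges : Set
  CoversAllEdges = ∀ u u' → Adj u u' → Traverses u u'

  -- no U-turns (cyclically): consecutive edges {v_i,v_{i+1}}, {v_{i+1},v_{i+2}}
  -- are distinct, i.e. v_{i+2} ≠ v_i
  NoUTurns : Set
  NoUTurns = ∀ i → ¬ (at (suc (suc i)) ≡ at i)

  PassesThrough : Vertex w h → Vertex w h → Vertex w h → Set
  PassesThrough v u u' = ∃ λ i → at i ≡ u × at (suc i) ≡ v × at (suc (suc i)) ≡ u'

  -- junction graph J(v): vertices = edges incident to v, identified with
  -- the neighbour u of v; u — u' an edge whenever the walk passes through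
  -- v between {u,v} and {v,u'} (undirected)
  JEdge : Vertex w h → Vertex w h → Vertex w h → Set
  JEdge v u u' = PassesThrough v u u' ⊎ PassesThrough v u' u

  JunctionConnected : Vertex w h → Set
  JunctionConnected v = ∀ u u' → Adj v u → Adj v u' → Star (JEdge v) u u'

  record IsThreading : Set where
    field
      covers     : CoversAllEdges
      noUTurns   : NoUTurns
      connected  : ∀ v → JunctionConnected v

-- At a vertex with both a horizontal and a vertical incident edge, connectivity of the
-- junction graph gives a path from a horizontal to a vertical edge, and the first step of
-- that path leaving the horizontal edges is a 90-degree turn.  Every vertex of a grid has
-- such edges unless the grid is a single row or column, i.e. a path; there the potential
-- row + column changes by exactly one along every edge, so at a position where it is
-- maximal along the walk both neighbouring positions have the same potential, hence are
-- the same vertex: a U-turn.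
module Submission where

open import Defs
open import Data.Nat using (ℕ; suc; _+_; _≤_; _%_)
open import Data.Nat.Properties using (+-suc; +-identityʳ; suc-injective; 1+n≰n; ≤-trans; ≤-reflexive)
open import Data.Nat.DivMod using (_mod_; [m+n]%n≡m%n; m<n⇒m%n≡m)
open import Data.Fin using (Fin; toℕ; inject₁; _≟_) renaming (zero to fzero; suc to fsuc)
open import Data.Fin.Properties using (toℕ-injective; toℕ-inject₁; toℕ-fromℕ<; toℕ<n)
open import Data.List using (allFin)
open import Data.List.Extrema.Nat using (argmax; f[xs]≤f[argmax])
open import Data.List.Membership.Propositional.Properties using (∈-allFin)
import Data.List.Relation.Unary.All as All
open import Data.Product using (∃; ∃₂; _×_; _,_)
open import Data.Sum using (_⊎_; inj₁; inj₂; swap) renaming (map to ⊎-map)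
open import Data.Empty using (⊥-elim)
open import Function using (_∘_)
open import Relation.Nullary using (¬_; yes; no; contradiction)
open import Relation.Unary using (Pred; Decidable)
open import Relation.Binary.PropositionalEquality
  using (_≡_; _≢_; refl; sym; trans; cong; module ≡-Reasoning)
open import Relation.Binary.Construct.Closure.ReflexiveTransitive using (Star; ε; _◅_)

star-crossing : ∀ {a r p} {A : Set a} {R : A → A → Set r} (P : Pred A p) → Decidable P →
  ∀ {x y} → Star R x y → P x → ¬ P y → ∃₂ λ u u′ → R u u′ × P u × ¬ P u′
star-crossing P P? ε px ¬py = contradiction px ¬py
star-crossing P P? (_◅_ {j = z} xRz z⋆y) px ¬py with P? z
... | yes pz = star-crossing P P? z⋆y pz ¬py
... | no ¬pz = _ , z , xRz , px , ¬pz

OneApart : ℕ → ℕ → Set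
OneApart m n = suc m ≡ n ⊎ suc n ≡ m

OneApart-≤⇒suc≡ : ∀ {m n} → OneApart m n → m ≤ n → suc m ≡ n
OneApart-≤⇒suc≡ (inj₁ 1+m≡n) _   = 1+m≡n
OneApart-≤⇒suc≡ (inj₂ refl)  m≤n = contradiction m≤n 1+n≰n

OneApart-peak : ∀ {a b c} → OneApart a b → OneApart b c → a ≤ b → c ≤ b → a ≡ c
OneApart-peak ab bc a≤b c≤b =
  suc-injective (trans (OneApart-≤⇒suc≡ ab a≤b) (sym (OneApart-≤⇒suc≡ (swap bc) c≤b)))

OneApart-+ˡ : ∀ k {m n} → OneApart m n → OneApart (k + m) (k + n)
OneApart-+ˡ k {m} {n} = ⊎-map (λ e → trans (sym (+-suc k m)) (cong (k +_) e))
                              (λ e → trans (sym (+-suc k n)) (cong (k +_) e))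

OneApart-+ʳ : ∀ k {m n} → OneApart m n → OneApart (m + k) (n + k)
OneApart-+ʳ k = ⊎-map (cong (_+ k)) (cong (_+ k))

OneApart-toℕ⇒≢ : ∀ {m} {i j : Fin m} → OneApart (toℕ i) (toℕ j) → i ≢ j
OneApart-toℕ⇒≢ (inj₁ e) refl = 1+n≰n (≤-reflexive e)
OneApart-toℕ⇒≢ (inj₂ e) refl = 1+n≰n (≤-reflexive e)

neighbour-or-singleton : ∀ {m} (i : Fin m) → (∃ λ (j : Fin m) → OneApart (toℕ i) (toℕ j)) ⊎ m ≡ 1
neighbour-or-singleton {suc 0}       fzero    = inj₂ refl
neighbour-or-singleton {suc (suc _)} fzero    = inj₁ (fsuc fzero , inj₁ refl)
neighbour-or-singleton               (fsuc i) = inj₁ (inject₁ i , inj₂ (cong suc (toℕ-inject₁ i)))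

module _ {w h : ℕ} where

  level : Vertex w h → ℕ
  level v = toℕ (row v) + toℕ (col v)

  level-OneApart : ∀ {u v : Vertex w h} → Adj u v → OneApart (level u) (level v)
  level-OneApart {r , _} {.r , _} (inj₁ (refl , c~c′)) = OneApart-+ˡ (toℕ r) c~c′
  level-OneApart {_ , c} {_ , .c} (inj₂ (refl , r~r′)) = OneApart-+ʳ (toℕ c) r~r′

level-injective-row : ∀ {h} {u v : Vertex 1 h} → level u ≡ level v → u ≡ v
level-injective-row {u = fzero , _} {fzero , _} e = cong (fzero ,_) (toℕ-injective e)

level-injective-col : ∀ {w} {u v : Vertex w 1} → level u ≡ level v → u ≡ v
level-injective-col {u = r , fzero} {r′ , fzero} e =
  cong (_, fzero) (toℕ-injective (trans (sym (+-identityʳ (toℕ r))) (trans e (+-identityʳ (toℕ r′)))))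

module _ {w h : ℕ} (W : ClosedWalk w h) where
  open ClosedWalk W

  at-after-one-lap : ∀ k → at (suc (toℕ k + n)) ≡ verts k
  at-after-one-lap k = cong verts (toℕ-injective (begin
    toℕ (suc (toℕ k + n) mod suc n) ≡⟨ toℕ-fromℕ< _ ⟩
    suc (toℕ k + n) % suc n         ≡⟨ cong (_% suc n) (sym (+-suc (toℕ k) n)) ⟩
    (toℕ k + suc n) % suc n         ≡⟨ [m+n]%n≡m%n (toℕ k) (suc n) ⟩
    toℕ k % suc n                   ≡⟨ m<n⇒m%n≡m (toℕ<n k) ⟩
    toℕ k                           ∎))
    where open ≡-Reasoning

  walk-maximum : (f : Vertex w h → ℕ) → ∃ λ j → ∀ i → f (at i) ≤ f (at (suc j))
  walk-maximum f = toℕ k + n , bound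
    where
    k = argmax (f ∘ verts) fzero (allFin (suc n))
    bound : ∀ i → f (at i) ≤ f (at (suc (toℕ k + n)))
    bound i = ≤-trans
      (All.lookup (f[xs]≤f[argmax] {f = f ∘ verts} fzero (allFin (suc n))) (∈-allFin (i mod suc n)))
      (≤-reflexive (cong f (sym (at-after-one-lap k))))

  potential-backtracks : (f : Vertex w h → ℕ) → (∀ {u v} → Adj u v → OneApart (f u) (f v)) →
    ∃ λ j → f (at (suc (suc j))) ≡ f (at j)
  potential-backtracks f f-step with walk-maximum f
  ... | j , max =
    j , sym (OneApart-peak (f-step (adjacent j)) (f-step (adjacent (suc j))) (max j) (max (suc (suc j))))

  -- The vertices are given explicitly: inferring them from  level u ≡ level v  makes
  -- the unifier unfold  at  through  _mod_ , which does not terminate in practice.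
  thin-grid-has-UTurn : w ≡ 1 ⊎ h ≡ 1 → ¬ NoUTurns W
  thin-grid-has-UTurn (inj₁ refl) noUTurn =
    let j , e = potential-backtracks level level-OneApart
    in noUTurn j (level-injective-row {u = at (suc (suc j))} {at j} e)
  thin-grid-has-UTurn (inj₂ refl) noUTurn =
    let j , e = potential-backtracks level level-OneApart
    in noUTurn j (level-injective-col {u = at (suc (suc j))} {at j} e)

  JEdge-turn : ∀ {v u u′} → JEdge W v u u′ → Horizontal v u → ¬ Horizontal v u′ →
    ∃ λ i → at (suc i) ≡ v × Perpendicular v (at i) (at (suc (suc i)))
  JEdge-turn (inj₁ (i , refl , at₁≡v , refl)) hu ¬hu′ = i , at₁≡v , inj₁ (hu , ¬hu′)
  JEdge-turn (inj₂ (i , refl , at₁≡v , refl)) hu ¬hu′ = i , at₁≡v , inj₂ (¬hu′ , hu)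

mainTheorem14 : (w h : ℕ) (W : ClosedWalk w h) → IsThreading W →
    (v : Vertex w h) →
    ∃ λ i → ClosedWalk.at W (suc i) ≡ v ×
    Perpendicular v (ClosedWalk.at W i) (ClosedWalk.at W (suc (suc i)))
mainTheorem14 w h W T v@(r , c) with neighbour-or-singleton c | neighbour-or-singleton r
... | inj₂ h≡1 | _        = ⊥-elim (thin-grid-has-UTurn W (inj₂ h≡1) (IsThreading.noUTurns T))
... | inj₁ _   | inj₂ w≡1 = ⊥-elim (thin-grid-has-UTurn W (inj₁ w≡1) (IsThreading.noUTurns T))
... | inj₁ (c′ , c~c′) | inj₁ (r′ , r~r′)
  with star-crossing (Horizontal v) (λ u → r ≟ row u)
         (IsThreading.connected T v (r , c′) (r′ , c) (inj₁ (refl , c~c′)) (inj₂ (refl , r~r′)))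
         refl (OneApart-toℕ⇒≢ r~r′)
... | _ , _ , turn , hu , ¬hu′ = JEdge-turn W turn hu ¬hu′
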